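{- Let $A$ and $B$ be two asynchronously composable IOTSes. For every state $(s_A,s_B)\in\mathit{reach}(A\otimes B)$, the state $((s_A,\epsilon),(s_B,\epsilon))$ belongs to $\mathit{reach}(\Omega(A)\otimes\Omega(B))$.
   Context: An IOTS $A=(\mathit{states}_A,\mathit{start}_A,\mathit{act}_A,\to_A)$ has states, initial state, actions $\mathit{act}_A=\mathit{in}_A\cup\mathit{out}_A\cup\mathit{int}_A$ (disjoint union of inputs, outputs, internal actions) and transitions $s\xrightarrow{a}_A s'$; $\mathit{reach}(A)$ is the set of states reachable from $\mathit{start}_A$ by finitely many transitions. $A,B$ are composable if $\mathit{act}_A\cap\mathit{act}_B=(\mathit{in}_A\cap\mathit{out}_B)\cup(\mathit{in}_B\cap\mathit{out}_A)=:\mathit{shared}(A,B)$. Synchronous composition $A\otimes B$: states $\mathit{states}_A\times\mathit{states}_B$, initial $(\mathit{start}_A,\mathit{start}_B)$, inputs $(\mathit{in}_A\cup\mathit{in}_B)\setminus\mathit{shared}(A,B)$, outputs $(\mathit{out}_A\cup\mathit{out}_B)\setminus\mathit{shared}(A,B)$, internal $\mathit{int}_A\cup\mathit{int}_B\cup\mathit{shared}(A,B)$; transitions: if $a\in\mathit{act}_A\setminus\mathit{shared}(A,B)$ and $s\xrightarrow{a}_A s'$ then $(s,t)\xrightarrow{a}(s',t)$ for all $t$; symmetrically for $B$; if $a\in\mathit{shared}(A,B)$, $s\xrightarrow{a}_A s'$ and $t\xrightarrow{a}_B t'$ then $(s,t)\xrightarrow{a}(s',t')$. For a set $M$, $M^\rhd=\{a^\rhd\mid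 a\in M\}$ are fresh names. $A,B$ are asynchronously composable if composable and $\mathit{shared}(A,B)^\rhd\cap(\mathit{act}_A\cup\mathit{act}_B)=\emptyset$. With $\mathit{out}_{AB}=\mathit{out}_A\cap\mathit{in}_B$, $\Omega(A)$ is the IOTS with states $(s,q)$, $s\in\mathit{states}_A$, $q\in\mathit{out}_{AB}^*$ (words; $\epsilon$ the empty word), initial $(\mathit{start}_A,\epsilon)$, inputs $\mathit{in}_A$, outputs $\mathit{out}_A$, internal actions $\mathit{int}_A\cup\mathit{out}_{AB}^\rhd$, transitions $(s,q)\xrightarrow{a}(s',q)$ if $s\xrightarrow{a}_A s'$, $a\notin\mathit{out}_{AB}$; $(s,q)\xrightarrow{a^\rhd}(s',qa)$ if $s\xrightarrow{a}_A s'$, $a\in\mathit{out}_{AB}$; $(s,aq)\xrightarrow{a}(s,q)$ for $a\in\mathit{out}_{AB}$. $\Omega(B)$ analogously with $\mathit{out}_{BA}=\mathit{out}_B\cap\mathit{in}_A$. $\Omega(A)\otimes\Omega(B)$ is their synchronous composition (they are composable). -}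

module Defs where

open import Data.Product using (Σ; _×_; _,_; proj₁; proj₂)
open import Data.Sum using (_⊎_)
open import Data.Empty using (⊥)
open import Data.List using (List; []; _∷_; [_]; _++_)
open import Data.List.Relation.Unary.All using (All; []; _∷_)
open import Relation.Nullary using (¬_)
open import Relation.Binary.PropositionalEquality using (_≡_)
open import Data.List.Relation.Unary.All.Properties using (++⁺)

Pred : Set → Set₁
Pred X = X → Set

_∪_ : {X : Set} → Pred X → Pred X → Pred X
(P ∪ Q) x = P x ⊎ Q x

_∩_ : {X : Set} → Pred X → Pred X → Pred X
(P ∩ Q) x = P x × Q x

_∖_ : {X : Set} → Pred X → Pred X → Pred X
(P ∖ Q) x = P x × ¬ Q x

module _ (Name : Set) where

  record IOTS : Set₁ where
    field
      States : Set
      start  : States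
      In     : Pred Name
      Out    : Pred Name
      Int    : Pred Name
      Step   : States → Name → States → Set

  open IOTS public

  act : IOTS → Pred Name
  act A = (In A ∪ Out A) ∪ Int A

  record WellFormed (A : IOTS) : Set where
    field
      in-out  : ∀ a → In A a → Out A a → ⊥
      in-int  : ∀ a → In A a → Int A a → ⊥
      out-int : ∀ a → Out A a → Int A a → ⊥
      labels  : ∀ s a s' → Step A s a s' → act A a

  data Reach (A : IOTS) : States A → Set where
    start-reach : Reach A (start A)
    step-reach  : ∀ {s a s'} → Reach A s → Step A s a s' → Reach A s'

  shared : IOTS → IOTS → Pred Name
  shared A B = (In A ∩ Out B) ∪ (In B ∩ Out A)

  Composable : IOTS → IOTS → Set
  Composable A B =
    (∀ a → (act A ∩ act B) a → shared A B a) ×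
    (∀ a → shared A B a → (act A ∩ act B) a)

  data SyncStep (A B : IOTS) : States A × States B → Name → States A × States B → Set where
    left  : ∀ {s s' t a} → act A a → ¬ shared A B a → Step A s a s' →
            SyncStep A B (s , t) a (s' , t)
    right : ∀ {s t t' a} → act B a → ¬ shared A B a → Step B t a t' →
            SyncStep A B (s , t) a (s , t')
    sync  : ∀ {s s' t t' a} → shared A B a → Step A s a s' → Step B t a t' →
            SyncStep A B (s , t) a (s' , t')

  _⊗_ : IOTS → IOTS → IOTS
  A ⊗ B = record
    { States = States A × States B
    ; start  = (start A , start B)
    ; In     = (In A ∪ In B) ∖ shared A B
    ; Out    = (Out A ∪ Out B) ∖ shared A B
    ; Int    = (Int A ∪ Int B) ∪ shared A B
    ; Step   = SyncStep A B
    }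

  module _ (_▷ : Name → Name) where

    _▷set : Pred Name → Pred Name
    (M ▷set) b = Σ Name λ a → M a × (a ▷ ≡ b)

    AsyncComposable : IOTS → IOTS → Set
    AsyncComposable A B =
      Composable A B × (∀ b → (shared A B ▷set) b → (act A ∪ act B) b → ⊥)

    outTo : IOTS → IOTS → Pred Name
    outTo A B = Out A ∩ In B

    Queue : IOTS → IOTS → Set
    Queue A B = Σ (List Name) (All (outTo A B))

    ε : (A B : IOTS) → Queue A B
    ε A B = ([] , [])

    data ΩStep (A B : IOTS) : States A × Queue A B → Name → States A × Queue A B → Set where
      local   : ∀ {s s' q a} → Step A s a s' → ¬ outTo A B a →
                ΩStep A B (s , q) a (s' , q)
      enqueue : ∀ {s s' a} {w : List Name} {pw : All (outTo A B) w} →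
                Step A s a s' → (pa : outTo A B a) →
                ΩStep A B (s , (w , pw)) (a ▷) (s' , (w ++ [ a ] , ++⁺ pw (pa ∷ [])))
      dequeue : ∀ {s a} {w : List Name} {pw : All (outTo A B) w} → (pa : outTo A B a) →
                ΩStep A B (s , (a ∷ w , pa ∷ pw)) a (s , (w , pw))

    Ω : IOTS → IOTS → IOTS
    Ω A B = record
      { States = States A × Queue A B
      ; start  = (start A , ε A B)
      ; In     = In A
      ; Out    = Out A
      ; Int    = Int A ∪ (outTo A B ▷set)
      ; Step   = ΩStep A B
      }

module Submission where

-- Every step of A ⊗ B is simulated in Ω(A) ⊗ Ω(B) with both queues empty
-- before and after: a local step is copied, and a handshake on a shared
-- action a sent by X to Y becomes the internal step a▷ of Ω(X), putting a
-- in its queue, followed by the handshake of Y on a with the dequeue of a.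
-- The enqueue step is not a handshake because a▷ is fresh for both alphabets.

open import Defs
open import Data.Product using (_,_; _×_)
open import Data.Sum using (inj₁; inj₂)
open import Function.Definitions using (Injective)
open import Relation.Nullary using (¬_)
open import Relation.Binary.PropositionalEquality using (_≡_; refl)

module _ (Name : Set) (_▷ : Name → Name) where

  act⇒act-Ω : ∀ (X Y : IOTS Name) {a} → act Name X a → act Name (Ω Name _▷ X Y) a
  act⇒act-Ω X Y (inj₁ io) = inj₁ io
  act⇒act-Ω X Y (inj₂ i)  = inj₂ (inj₁ i)

  output⇒¬outTo-partner : ∀ {X} (Y : IOTS Name) → WellFormed Name X →
                          ∀ {a} → Out X a → ¬ outTo Name _▷ Y X a
  output⇒¬outTo-partner _ wX oX (_ , iX) = WellFormed.in-out wX _ iX oX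

  ▷-not-shared : ∀ (A B : IOTS Name) → AsyncComposable Name _▷ A B →
                 ∀ {a} → shared Name A B a →
                 ¬ shared Name (Ω Name _▷ A B) (Ω Name _▷ B A) (a ▷)
  ▷-not-shared _ _ (_ , fresh) sh (inj₁ (iA , _)) = fresh _ (_ , sh , refl) (inj₁ (inj₁ (inj₁ iA)))
  ▷-not-shared _ _ (_ , fresh) sh (inj₂ (iB , _)) = fresh _ (_ , sh , refl) (inj₂ (inj₁ (inj₁ iB)))

  module Simulation (A B : IOTS Name) (wA : WellFormed Name A) (wB : WellFormed Name B)
                    (async : AsyncComposable Name _▷ A B) where

    ΩA⊗ΩB : IOTS Name
    ΩA⊗ΩB = _⊗_ Name (Ω Name _▷ A B) (Ω Name _▷ B A)

    with-empty-queues : States A × States B → States ΩA⊗ΩB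
    with-empty-queues (sA , sB) = (sA , ε Name _▷ A B) , (sB , ε Name _▷ B A)

    simulate-step : ∀ {p a p'} → SyncStep Name A B p a p' →
                    Reach Name ΩA⊗ΩB (with-empty-queues p) →
                    Reach Name ΩA⊗ΩB (with-empty-queues p')
    simulate-step (left x ¬sh st) r =
      step-reach r (left (act⇒act-Ω A B x) ¬sh (local st λ (o , i) → ¬sh (inj₂ (i , o))))
    simulate-step (right x ¬sh st) r =
      step-reach r (right (act⇒act-Ω B A x) ¬sh (local st λ (o , i) → ¬sh (inj₁ (i , o))))
    simulate-step (sync sh@(inj₂ (iB , oA)) stA stB) r =
      step-reach
        (step-reach r (left (inj₂ (inj₂ (_ , (oA , iB) , refl))) (▷-not-shared A B async sh)
                            (enqueue stA (oA , iB))))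
        (sync sh (dequeue (oA , iB)) (local stB (output⇒¬outTo-partner B wA oA)))
    simulate-step (sync sh@(inj₁ (iA , oB)) stA stB) r =
      step-reach
        (step-reach r (right (inj₂ (inj₂ (_ , (oB , iA) , refl))) (▷-not-shared A B async sh)
                             (enqueue stB (oB , iA))))
        (sync sh (local stA (output⇒¬outTo-partner A wB oB)) (dequeue (oB , iA)))

    simulate-reach : ∀ {p} → Reach Name (_⊗_ Name A B) p → Reach Name ΩA⊗ΩB (with-empty-queues p)
    simulate-reach start-reach       = start-reach
    simulate-reach (step-reach r st) = simulate-step st (simulate-reach r)

lemma4p8 : (Name : Set) (_▷ : Name → Name) → Injective _≡_ _≡_ _▷ →
           (A B : IOTS Name) → WellFormed Name A → WellFormed Name B →
           AsyncComposable Name _▷ A B →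
           (sA : States A) (sB : States B) →
           Reach Name (_⊗_ Name A B) (sA , sB) →
           Reach Name (_⊗_ Name (Ω Name _▷ A B) (Ω Name _▷ B A))
             ((sA , ε Name _▷ A B) , (sB , ε Name _▷ B A))
lemma4p8 Name _▷ _ A B wA wB async sA sB =
  Simulation.simulate-reach Name _▷ A B wA wB async
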